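{- Let $q$ be a power of an odd prime and let $\mathcal{A},\mathcal{B}\subseteq\mathbb{F}_q$ satisfy $|\mathcal{A}||\mathcal{B}|>q(\sqrt{q}+1)$. Then the product set $\mathcal{A}\mathcal{B}=\{ab: a\in\mathcal{A}, b\in\mathcal{B}\}$ contains a $3$-term arithmetic progression, i.e. there exist $x_0,x_1,x_2\in\mathcal{A}$ and $y_0,y_1,y_2\in\mathcal{B}$ with $x_0y_0+x_2y_2=2x_1y_1$ and $x_0y_0\neq x_1y_1$ (equivalently, $x_0y_0, x_1y_1, x_2y_2$ are three distinct terms in arithmetic progression).
   Context: $\mathbb{F}_q$ is the finite field with $q$ elements. -}

module Defs where

open import Level using (0ℓ)
open import Algebra.Bundles using (CommutativeRing)
open import Data.Nat using (ℕ; _∸_; _^_; _<_)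
open import Data.Nat.Primality using (Prime)
open import Data.Fin using (Fin)
open import Data.Product using (∃; _×_)
open import Relation.Nullary using (¬_)
open import Relation.Binary.Definitions using (Decidable)
open import Relation.Binary.PropositionalEquality using (_≡_; _≢_)

record FiniteField : Set₁ where
  field
    commRing : CommutativeRing 0ℓ 0ℓ
  open CommutativeRing commRing public
  field
    0≉1       : ¬ (0# ≈ 1#)
    inverse   : ∀ x → ¬ (x ≈ 0#) → ∃ λ y → x * y ≈ 1#
    _≟_       : Decidable _≈_
    size      : ℕ
    enum      : Fin size → Carrier
    enum-inj  : ∀ i j → enum i ≈ enum j → i ≡ j
    enum-surj : ∀ x → ∃ λ i → enum i ≈ x

OddPrimePower : ℕ → Set
OddPrimePower q = ∃ λ p → ∃ λ k → Prime p × p ≢ 2 × 0 < k × q ≡ p ^ k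

-- q (√q + 1) < n, expressed in ℕ:  n - q > q √q  ⇔  n > q  and  (n - q)^2 > q^3.
QSqrtQPlusOneLt : ℕ → ℕ → Set
QSqrtQPlusOneLt q n = q < n × q ^ 3 < (n ∸ q) ^ 2

module Submission where

open import Defs
open import Data.Fin using (Fin)
open import Data.Fin.Subset using (Subset; _∈_; ∣_∣)
open import Data.Nat using () renaming (_*_ to _*ℕ_)
open import Data.Product using (∃; _×_)
open import Relation.Nullary using (¬_; yes; no)

-- Fix c = x₁ y₁ ≠ 0 with x₁ ∈ A, y₁ ∈ B and put t = 2 c. Each nonzero u ∈ A² is the normal of the line
-- {v : u · v = t} of F_q²; there are K = |A|² - z² of them (z = 1 if 0 ∈ A, else 0), each has q points,
-- and two distinct ones meet at most once. So the number d(v) of these lines through v satisfies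
-- Σ d = q K and Σ d² ≤ q K + K², whence Σ_v (K - q d(v))² ≤ q³ K, and Cauchy-Schwarz over v ∈ B²
-- bounds the number N of solutions of x₀ y₀ + x₂ y₂ = t in A² × B² by (K |B|² - q N)² ≤ q³ K |B|².
-- If no solution gave a progression, every one would have x₀ y₀ = c = x₂ y₂, so N ≤ R² for the
-- number R ≤ min (|A| - z) |B| of representations c = x y; with q < |A| |B| and q³ < (|A| |B| - q)²
-- these bounds are incompatible.

module IntegerInequalities where

  open import Data.Nat.Base using (z≤n)
  open import Data.Integer.Base using (ℤ; +_; +0; +[1+_]; -[1+_]; 0ℤ; 1ℤ; _+_; _*_; -_; _-_; _≤_; _<_; +≤+; positive)
  open import Data.Integer.Properties
    using (≤-refl; ≤-trans; pos-*; *-comm; *-zeroʳ; *-monoˡ-≤-nonNeg; *-monoˡ-<-pos; +-inverseʳ; +-monoˡ-<; 0≤i-j⇒j≤i)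
  open import Data.Sum.Base using (_⊎_; inj₁; inj₂)
  open import Relation.Binary.PropositionalEquality using (_≡_; refl; sym; subst)

  square-nonneg : ∀ x → 0ℤ ≤ x * x
  square-nonneg +0       = +≤+ z≤n
  square-nonneg +[1+ n ] = +≤+ z≤n
  square-nonneg -[1+ n ] = +≤+ z≤n

  *-nonneg : ∀ {x y} → 0ℤ ≤ x → 0ℤ ≤ y → 0ℤ ≤ x * y
  *-nonneg {+ m} {+ n} _ _ = subst (0ℤ ≤_) (pos-* m n) (+≤+ z≤n)

  *-monoˡ-≤-0≤ : ∀ {c x y} → 0ℤ ≤ c → x ≤ y → c * x ≤ c * y
  *-monoˡ-≤-0≤ {+ n} _ = *-monoˡ-≤-nonNeg (+ n)

  *-monoˡ-<-0< : ∀ {c x y} → 0ℤ < c → x < y → c * x < c * y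
  *-monoˡ-<-0< {c} 0<c = *-monoˡ-<-pos c {{positive 0<c}}

  *-pos : ∀ {x y} → 0ℤ < x → 0ℤ < y → 0ℤ < x * y
  *-pos {x} {y} 0<x 0<y = subst (_< x * y) (*-zeroʳ x) (*-monoˡ-<-0< 0<x 0<y)

  <⇒0<- : ∀ {x y} → x < y → 0ℤ < y - x
  <⇒0<- {x} {y} x<y = subst (_< y - x) (+-inverseʳ x) (+-monoˡ-< (- x) x<y)

  square-mono-≤ : ∀ {x y} → 0ℤ ≤ x → x ≤ y → x * x ≤ y * y
  square-mono-≤ {x} {y} 0≤x x≤y =
    ≤-trans (*-monoˡ-≤-0≤ 0≤x x≤y) (subst (_≤ y * y) (*-comm y x) (*-monoˡ-≤-0≤ (≤-trans 0≤x x≤y) x≤y))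

  ≤-by-gap : ∀ {x y} (d : ℤ) → y - x ≡ d → 0ℤ ≤ d → x ≤ y
  ≤-by-gap d y-x≡d 0≤d = 0≤i-j⇒j≤i (subst (0ℤ ≤_) (sym y-x≡d) 0≤d)

  bit-nonneg : ∀ {z} → z ≡ 0ℤ ⊎ z ≡ 1ℤ → 0ℤ ≤ z
  bit-nonneg (inj₁ refl) = +≤+ z≤n
  bit-nonneg (inj₂ refl) = +≤+ z≤n

  bit-≤1 : ∀ {z} → z ≡ 0ℤ ⊎ z ≡ 1ℤ → z ≤ 1ℤ
  bit-≤1 (inj₁ refl) = +≤+ z≤n
  bit-≤1 (inj₂ refl) = ≤-refl

module FiniteSums where

  open import Level using (Level)
  open import Data.Nat.Base using (ℕ; zero; suc; z≤n)
  open import Data.Fin.Base using (Fin; zero; suc)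
  open import Data.Fin.Properties using (any?; suc-injective) renaming (_≟_ to _≟ᶠ_)
  open import Data.Fin.Subset using (Subset; inside; outside; ∣_∣)
  open import Data.Fin.Subset.Properties using (_∈?_; drop-there)
  open import Data.Vec.Base using ([]; _∷_; there)
  open import Data.Integer.Base using (ℤ; -1ℤ; +_; 0ℤ; 1ℤ; _+_; _*_; -_; _-_; _≤_; _<_; +≤+; positive)
  open import Data.Integer.Properties
    using (+-*-semiring; +-identityˡ; +-identityʳ; *-zeroˡ; *-zeroʳ; *-identityˡ; suc-*; -1*i≡-i;
           ≤-refl; ≤-reflexive; ≤-trans; ≤-antisym; +-mono-≤; *-cancelˡ-≤-pos; 0≤i-j⇒j≤i)
  open import Data.Integer.Tactic.RingSolver using (solve-∀)
  open import Data.Sum.Base using (_⊎_; inj₁; inj₂)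
  open import Data.Product.Base using (_×_; _,_; proj₁; proj₂)
  open import Data.Product.Properties using (≡-dec)
  open import Function.Base using (_∘_)
  open import Relation.Nullary using (¬_; Dec; yes; no; contradiction; _×-dec_; ¬?)
  open import Relation.Binary.Definitions using (DecidableEquality)
  open import Relation.Binary.PropositionalEquality using (_≡_; _≢_; refl; sym; trans; cong; cong₂; subst; module ≡-Reasoning)
  open import Algebra.Properties.Semiring.Sum +-*-semiring
    using (sum; sum-syntax; ∑-distrib-+; ∑-comm; *-distribˡ-sum; *-distribʳ-sum; sum-cong-≗)
  open IntegerInequalities using (square-nonneg)

  private variable
    m n : ℕ
    ℓ ℓ′ : Level
    P : Set ℓ
    Q : Set ℓ′

  𝟙 : Dec P → ℤ
  𝟙 (yes _) = 1ℤ
  𝟙 (no _)  = 0ℤ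

  𝟙-yes : (d : Dec P) → P → 𝟙 d ≡ 1ℤ
  𝟙-yes (yes _) _  = refl
  𝟙-yes (no ¬p) p = contradiction p ¬p

  𝟙-no : (d : Dec P) → ¬ P → 𝟙 d ≡ 0ℤ
  𝟙-no (yes p) ¬p = contradiction p ¬p
  𝟙-no (no _)  _  = refl

  𝟙-nonneg : (d : Dec P) → 0ℤ ≤ 𝟙 d
  𝟙-nonneg (yes _) = +≤+ z≤n
  𝟙-nonneg (no _)  = +≤+ z≤n

  𝟙-bit : (d : Dec P) → 𝟙 d ≡ 0ℤ ⊎ 𝟙 d ≡ 1ℤ
  𝟙-bit (yes _) = inj₂ refl
  𝟙-bit (no _)  = inj₁ refl

  𝟙-idem : (d : Dec P) → 𝟙 d * 𝟙 d ≡ 𝟙 d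
  𝟙-idem (yes _) = refl
  𝟙-idem (no _)  = refl

  𝟙-mono : (d : Dec P) (e : Dec Q) → (P → Q) → 𝟙 d ≤ 𝟙 e
  𝟙-mono (yes _) (yes _) _   = ≤-refl
  𝟙-mono (yes p) (no ¬q) p⇒q = contradiction (p⇒q p) ¬q
  𝟙-mono (no _)  e       _   = 𝟙-nonneg e

  𝟙-cong : (d : Dec P) (e : Dec Q) → (P → Q) → (Q → P) → 𝟙 d ≡ 𝟙 e
  𝟙-cong d e p⇒q q⇒p = ≤-antisym (𝟙-mono d e p⇒q) (𝟙-mono e d q⇒p)

  𝟙-×-¬ : (d : Dec P) (e : Dec Q) → 𝟙 (d ×-dec ¬? e) ≡ 𝟙 d - 𝟙 e * 𝟙 d
  𝟙-×-¬ (yes _) (yes _) = refl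
  𝟙-×-¬ (yes _) (no _)  = refl
  𝟙-×-¬ (no _)  (yes _) = refl
  𝟙-×-¬ (no _)  (no _)  = refl

  𝟙-× : (d : Dec P) (e : Dec Q) → 𝟙 (d ×-dec e) ≡ 𝟙 d * 𝟙 e
  𝟙-× (yes _) (yes _) = refl
  𝟙-× (yes _) (no _)  = refl
  𝟙-× (no _)  (yes _) = refl
  𝟙-× (no _)  (no _)  = refl

  ∑-mono : {f g : Fin n → ℤ} → (∀ i → f i ≤ g i) → sum f ≤ sum g
  ∑-mono {zero}  f≤g = ≤-refl
  ∑-mono {suc n} f≤g = +-mono-≤ (f≤g zero) (∑-mono (f≤g ∘ suc))

  ∑-zero : ∀ n → ∑[ i < n ] 0ℤ ≡ 0ℤ
  ∑-zero zero    = refl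
  ∑-zero (suc n) = trans (+-identityˡ _) (∑-zero n)

  ∑-const : ∀ n (c : ℤ) → ∑[ i < n ] c ≡ + n * c
  ∑-const zero    c = sym (*-zeroˡ c)
  ∑-const (suc n) c = trans (cong (λ s → c + s) (∑-const n c)) (sym (suc-* (+ n) c))

  ∑-single : ∀ {f : Fin n → ℤ} i → (∀ j → j ≢ i → f j ≡ 0ℤ) → sum f ≡ f i
  ∑-single {suc n} {f} zero others = begin
    f zero + ∑[ j < n ] f (suc j) ≡⟨ cong (λ s → f zero + s) (sum-cong-≗ (λ j → others (suc j) λ ())) ⟩
    f zero + ∑[ j < n ] 0ℤ        ≡⟨ cong (λ s → f zero + s) (∑-zero n) ⟩
    f zero + 0ℤ                   ≡⟨ +-identityʳ (f zero) ⟩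
    f zero                        ∎
    where open ≡-Reasoning
  ∑-single {suc n} {f} (suc i) others = begin
    f zero + ∑[ j < n ] f (suc j) ≡⟨ cong (_+ ∑[ j < n ] f (suc j)) (others zero λ ()) ⟩
    0ℤ + ∑[ j < n ] f (suc j)     ≡⟨ +-identityˡ _ ⟩
    ∑[ j < n ] f (suc j)          ≡⟨ ∑-single i (λ j j≢i → others (suc j) (j≢i ∘ suc-injective)) ⟩
    f (suc i)                     ∎
    where open ≡-Reasoning

  ∑-delta : ∀ (i : Fin n) (f : Fin n → ℤ) → ∑[ j < n ] (𝟙 (i ≟ᶠ j) * f j) ≡ f i
  ∑-delta i f = begin
    ∑[ j < _ ] (𝟙 (i ≟ᶠ j) * f j) ≡⟨ ∑-single i (λ j j≢i → trans (cong (_* f j) (𝟙-no (i ≟ᶠ j) (j≢i ∘ sym))) (*-zeroˡ (f j))) ⟩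
    𝟙 (i ≟ᶠ i) * f i             ≡⟨ cong (_* f i) (𝟙-yes (i ≟ᶠ i) refl) ⟩
    1ℤ * f i                     ≡⟨ *-identityˡ (f i) ⟩
    f i                          ∎
    where open ≡-Reasoning

  module _ {P : Fin n → Set ℓ} (P? : ∀ i → Dec (P i)) where

    ∑-𝟙-unique : ∀ i → P i → (∀ j → P j → j ≡ i) → ∑[ j < n ] 𝟙 (P? j) ≡ 1ℤ
    ∑-𝟙-unique i pi unique =
      trans (∑-single i (λ j j≢i → 𝟙-no (P? j) (j≢i ∘ unique j))) (𝟙-yes (P? i) pi)

    ∑-𝟙-atMostOne : (Q? : Dec Q) → (∀ i → P i → Q) → (∀ i j → P i → P j → i ≡ j) → ∑[ j < n ] 𝟙 (P? j) ≤ 𝟙 Q?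
    ∑-𝟙-atMostOne Q? P⇒Q unique with any? P?
    ... | yes (i , pi) = ≤-reflexive (trans (∑-𝟙-unique i pi (λ j pj → unique j i pj pi)) (sym (𝟙-yes Q? (P⇒Q i pi))))
    ... | no ∄P        = ≤-trans (≤-reflexive (trans (sum-cong-≗ λ j → 𝟙-no (P? j) (∄P ∘ (j ,_))) (∑-zero n))) (𝟙-nonneg Q?)

  ∑[f-g]≡∑f-∑g : (f g : Fin n → ℤ) → ∑[ i < n ] (f i - g i) ≡ sum f - sum g
  ∑[f-g]≡∑f-∑g {n} f g = begin
    ∑[ i < n ] (f i - g i)             ≡⟨ ∑-distrib-+ f (λ i → - g i) ⟩
    sum f + ∑[ i < n ] (- g i)         ≡⟨ cong (_+_ (sum f)) (sum-cong-≗ λ i → sym (-1*i≡-i (g i))) ⟩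
    sum f + ∑[ i < n ] (-1ℤ * g i)     ≡⟨ cong (_+_ (sum f)) (*-distribˡ-sum -1ℤ g) ⟨
    sum f + -1ℤ * sum g                ≡⟨ cong (_+_ (sum f)) (-1*i≡-i (sum g)) ⟩
    sum f - sum g                      ∎
    where open ≡-Reasoning

  ∑² : (Fin m × Fin n → ℤ) → ℤ
  ∑² {m} {n} f = ∑[ i < m ] ∑[ j < n ] f (i , j)

  ∑²-zero : ∀ m n → ∑² {m} {n} (λ _ → 0ℤ) ≡ 0ℤ
  ∑²-zero m n = trans (sum-cong-≗ {m} λ _ → ∑-zero n) (∑-zero m)

  ∑²-cong : {f g : Fin m × Fin n → ℤ} → (∀ u → f u ≡ g u) → ∑² f ≡ ∑² g
  ∑²-cong f≗g = sum-cong-≗ λ i → sum-cong-≗ λ j → f≗g (i , j)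

  ∑²-mono : {f g : Fin m × Fin n → ℤ} → (∀ u → f u ≤ g u) → ∑² f ≤ ∑² g
  ∑²-mono f≤g = ∑-mono λ i → ∑-mono λ j → f≤g (i , j)

  ∑²-nonneg : {f : Fin m × Fin n → ℤ} → (∀ u → 0ℤ ≤ f u) → 0ℤ ≤ ∑² f
  ∑²-nonneg {m} {n} 0≤f = ≤-trans (≤-reflexive (sym (∑²-zero m n))) (∑²-mono 0≤f)

  ∑²-distrib-+ : (f g : Fin m × Fin n → ℤ) → ∑² (λ u → f u + g u) ≡ ∑² f + ∑² g
  ∑²-distrib-+ {m} {n} f g = begin
    ∑[ i < m ] ∑[ j < n ] (f (i , j) + g (i , j))
      ≡⟨ sum-cong-≗ (λ i → ∑-distrib-+ (λ j → f (i , j)) (λ j → g (i , j))) ⟩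
    ∑[ i < m ] (∑[ j < n ] f (i , j) + ∑[ j < n ] g (i , j))
      ≡⟨ ∑-distrib-+ (λ i → ∑[ j < n ] f (i , j)) (λ i → ∑[ j < n ] g (i , j)) ⟩
    ∑² f + ∑² g ∎
    where open ≡-Reasoning

  *-distribˡ-∑² : (c : ℤ) (f : Fin m × Fin n → ℤ) → c * ∑² f ≡ ∑² (λ u → c * f u)
  *-distribˡ-∑² {m} {n} c f = begin
    c * ∑² f                             ≡⟨ *-distribˡ-sum c (λ i → ∑[ j < n ] f (i , j)) ⟩
    ∑[ i < m ] (c * ∑[ j < n ] f (i , j)) ≡⟨ sum-cong-≗ (λ i → *-distribˡ-sum c (λ j → f (i , j))) ⟩
    ∑² (λ u → c * f u)                   ∎
    where open ≡-Reasoning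

  ∑²-const : ∀ m n (c : ℤ) → ∑² {m} {n} (λ _ → c) ≡ + m * (+ n * c)
  ∑²-const m n c = begin
    ∑[ i < m ] ∑[ j < n ] c ≡⟨ sum-cong-≗ {m} (λ _ → ∑-const n c) ⟩
    ∑[ i < m ] (+ n * c)    ≡⟨ ∑-const m (+ n * c) ⟩
    + m * (+ n * c)         ∎
    where open ≡-Reasoning

  ∑²-comm : ∀ {m n m′ n′} (g : Fin m × Fin n → Fin m′ × Fin n′ → ℤ) →
            ∑² (λ u → ∑² (λ v → g u v)) ≡ ∑² (λ v → ∑² (λ u → g u v))
  ∑²-comm g = begin
    ∑[ i < _ ] ∑[ j < _ ] ∑[ k < _ ] ∑[ l < _ ] g (i , j) (k , l)
      ≡⟨ sum-cong-≗ (λ i → ∑-comm λ j k → ∑[ l < _ ] g (i , j) (k , l)) ⟩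
    ∑[ i < _ ] ∑[ k < _ ] ∑[ j < _ ] ∑[ l < _ ] g (i , j) (k , l)
      ≡⟨ ∑-comm (λ i k → ∑[ j < _ ] ∑[ l < _ ] g (i , j) (k , l)) ⟩
    ∑[ k < _ ] ∑[ i < _ ] ∑[ j < _ ] ∑[ l < _ ] g (i , j) (k , l)
      ≡⟨ sum-cong-≗ (λ k → sum-cong-≗ λ i → ∑-comm λ j l → g (i , j) (k , l)) ⟩
    ∑[ k < _ ] ∑[ i < _ ] ∑[ l < _ ] ∑[ j < _ ] g (i , j) (k , l)
      ≡⟨ sum-cong-≗ (λ k → ∑-comm λ i l → ∑[ j < _ ] g (i , j) (k , l)) ⟩
    ∑[ k < _ ] ∑[ l < _ ] ∑[ i < _ ] ∑[ j < _ ] g (i , j) (k , l) ∎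
    where open ≡-Reasoning

  ∑²-*-∑² : ∀ {m n m′ n′} (f : Fin m × Fin n → ℤ) (g : Fin m′ × Fin n′ → ℤ) →
            ∑² f * ∑² g ≡ ∑² (λ u → ∑² (λ v → f u * g v))
  ∑²-*-∑² {n = n} f g =
    trans (*-distribʳ-sum (∑² g) (λ i → ∑[ j < n ] f (i , j)))
          (sum-cong-≗ λ i → trans (*-distribʳ-sum (∑² g) (λ j → f (i , j)))
                                  (sum-cong-≗ λ j → *-distribˡ-∑² (f (i , j)) g))

  ∑-*-∑ : ∀ {m n} (f : Fin m → ℤ) (g : Fin n → ℤ) → sum f * sum g ≡ ∑² (λ (i , j) → f i * g j)
  ∑-*-∑ {m} {n} f g = trans (*-distribʳ-sum (sum g) f) (sum-cong-≗ {m} λ i → *-distribˡ-sum (f i) g)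

  ∑²-transpose : ∀ {m n} (h : Fin m → Fin m → Fin n → Fin n → ℤ) →
    ∑² (λ (i , i′) → ∑² (λ (j , j′) → h i i′ j j′)) ≡ ∑² (λ (i , j) → ∑² (λ (i′ , j′) → h i i′ j j′))
  ∑²-transpose h = sum-cong-≗ λ i → ∑-comm λ i′ j → ∑[ j′ < _ ] h i i′ j j′

  _≟²_ : DecidableEquality (Fin m × Fin n)
  _≟²_ = ≡-dec _≟ᶠ_ _≟ᶠ_

  ∑²-single : ∀ {f : Fin m × Fin n → ℤ} u → (∀ v → v ≢ u → f v ≡ 0ℤ) → ∑² f ≡ f u
  ∑²-single {m} {n} {f} (i , j) others = begin
    ∑[ k < m ] ∑[ l < n ] f (k , l) ≡⟨ ∑-single i (λ k k≢i → trans (sum-cong-≗ λ l → others (k , l) (k≢i ∘ cong proj₁)) (∑-zero n)) ⟩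
    ∑[ l < n ] f (i , l)            ≡⟨ ∑-single j (λ l l≢j → others (i , l) (l≢j ∘ cong proj₂)) ⟩
    f (i , j)                       ∎
    where open ≡-Reasoning

  ∑²-delta : ∀ (u : Fin m × Fin n) (f : Fin m × Fin n → ℤ) → ∑² (λ v → 𝟙 (u ≟² v) * f v) ≡ f u
  ∑²-delta u f = begin
    ∑² (λ v → 𝟙 (u ≟² v) * f v) ≡⟨ ∑²-single u (λ v v≢u → trans (cong (_* f v) (𝟙-no (u ≟² v) (v≢u ∘ sym))) (*-zeroˡ (f v))) ⟩
    𝟙 (u ≟² u) * f u            ≡⟨ cong (_* f u) (𝟙-yes (u ≟² u) refl) ⟩
    1ℤ * f u                    ≡⟨ *-identityˡ (f u) ⟩
    f u                         ∎
    where open ≡-Reasoning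

  ∑²-𝟙-atMostOne : {P : Fin m × Fin n → Set ℓ} (P? : ∀ u → Dec (P u)) →
                   (∀ u v → P u → P v → u ≡ v) → ∑² (λ v → 𝟙 (P? v)) ≤ 1ℤ
  ∑²-𝟙-atMostOne {m} {n} P? unique with any? (λ i → any? (λ j → P? (i , j)))
  ... | yes (i , j , pu) = ≤-reflexive (trans (∑²-single (i , j) λ v v≢u → 𝟙-no (P? v) (v≢u ∘ λ pv → unique v (i , j) pv pu))
                                               (𝟙-yes (P? (i , j)) pu))
  ... | no ∄P = ≤-trans (≤-reflexive (trans (∑²-cong λ (i , j) → 𝟙-no (P? (i , j)) (∄P ∘ λ pu → i , j , pu)) (∑²-zero m n)))
                        (+≤+ z≤n)

  ∑²-linear₂ : ∀ (a b : ℤ) (f g : Fin m × Fin n → ℤ) → ∑² (λ w → a * f w + b * g w) ≡ a * ∑² f + b * ∑² g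
  ∑²-linear₂ a b f g = trans (∑²-distrib-+ (λ w → a * f w) (λ w → b * g w))
                             (sym (cong₂ _+_ (*-distribˡ-∑² a f) (*-distribˡ-∑² b g)))

  ∑²[f-g]≡∑²f-∑²g : (f g : Fin m × Fin n → ℤ) → ∑² (λ w → f w - g w) ≡ ∑² f - ∑² g
  ∑²[f-g]≡∑²f-∑²g {m} {n} f g = trans (sum-cong-≗ {m} λ i → ∑[f-g]≡∑f-∑g (λ j → f (i , j)) (λ j → g (i , j)))
                                   (∑[f-g]≡∑f-∑g (λ i → ∑[ j < n ] f (i , j)) (λ i → ∑[ j < n ] g (i , j)))

  ∑²-linear₃ : ∀ (a b c : ℤ) (f g h : Fin m × Fin n → ℤ) →
    ∑² (λ w → a * f w + (b * g w + c * h w)) ≡ a * ∑² f + (b * ∑² g + c * ∑² h)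
  ∑²-linear₃ a b c f g h = begin
    ∑² (λ w → a * f w + (b * g w + c * h w))
      ≡⟨ ∑²-distrib-+ (λ w → a * f w) (λ w → b * g w + c * h w) ⟩
    ∑² (λ w → a * f w) + ∑² (λ w → b * g w + c * h w)
      ≡⟨ cong₂ _+_ (sym (*-distribˡ-∑² a f)) (∑²-linear₂ b c g h) ⟩
    a * ∑² f + (b * ∑² g + c * ∑² h) ∎
    where open ≡-Reasoning

  cauchy-schwarz : (u v : Fin m × Fin n → ℤ) → 0ℤ < ∑² (λ w → u w * u w) →
    ∑² (λ w → u w * v w) * ∑² (λ w → u w * v w) ≤ ∑² (λ w → u w * u w) * ∑² (λ w → v w * v w)
  cauchy-schwarz u v 0<A = 0≤i-j⇒j≤i (*-cancelˡ-≤-pos 0ℤ (A * D - C * C) A {{positive 0<A}}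
    (≤-trans (≤-reflexive (*-zeroʳ A)) (subst (0ℤ ≤_) expand (∑²-nonneg λ w → square-nonneg (A * v w - C * u w)))))
    where
    A = ∑² (λ w → u w * u w)
    C = ∑² (λ w → u w * v w)
    D = ∑² (λ w → v w * v w)
    expand : ∑² (λ w → (A * v w - C * u w) * (A * v w - C * u w)) ≡ A * (A * D - C * C)
    expand = begin
      ∑² (λ w → (A * v w - C * u w) * (A * v w - C * u w))
        ≡⟨ ∑²-cong (λ w → square-expansion A C (u w) (v w)) ⟩
      ∑² (λ w → (A * A) * (v w * v w) + (- (A * C + A * C) * (u w * v w) + (C * C) * (u w * u w)))
        ≡⟨ ∑²-linear₃ (A * A) (- (A * C + A * C)) (C * C) (λ w → v w * v w) (λ w → u w * v w) (λ w → u w * u w) ⟩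
      (A * A) * D + (- (A * C + A * C) * C + (C * C) * A)
        ≡⟨ collect A C D ⟩
      A * (A * D - C * C) ∎
      where
      open ≡-Reasoning
      square-expansion : ∀ a c x y → (a * y - c * x) * (a * y - c * x) ≡ (a * a) * (y * y) + (- (a * c + a * c) * (x * y) + (c * c) * (x * x))
      square-expansion = solve-∀
      collect : ∀ a c d → (a * a) * d + (- (a * c + a * c) * c + (c * c) * a) ≡ a * (a * d - c * c)
      collect = solve-∀

  ∣p∣≡∑𝟙∈ : ∀ {n} (p : Subset n) → + ∣ p ∣ ≡ ∑[ i < n ] 𝟙 (i ∈? p)
  ∣p∣≡∑𝟙∈ []           = refl
  ∣p∣≡∑𝟙∈ (inside ∷ p)  = cong (_+_ 1ℤ) (trans (∣p∣≡∑𝟙∈ p) (sum-cong-≗ λ i → 𝟙-cong (i ∈? p) (suc i ∈? inside ∷ p) there drop-there))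
  ∣p∣≡∑𝟙∈ (outside ∷ p) = trans (∣p∣≡∑𝟙∈ p) (trans (sum-cong-≗ λ i → 𝟙-cong (i ∈? p) (suc i ∈? outside ∷ p) there drop-there) (sym (+-identityˡ _)))

module SubsetLemmas where

  open import Data.Nat.Base using (_≤_)
  open import Data.Nat.Properties using (≤-trans; ≤-reflexive; <-irrefl)
  open import Data.Fin.Properties using (any?; _≟_)
  open import Data.Fin.Subset using (Subset; _∈_; _⊆_; ∣_∣; ⁅_⁆)
  open import Data.Empty using (⊥-elim)
  open import Data.Fin.Subset.Properties using (_∈?_; x∈⁅x⁆; ∣⁅x⁆∣≡1; p⊆q⇒∣p∣≤∣q∣)
  open import Data.Product.Base using (∃; _×_; _,_)
  open import Relation.Nullary using (yes; no; ¬?; _×-dec_)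
  open import Relation.Binary.PropositionalEquality using (_≢_; refl)

  ∃-∈-≢ : ∀ {n} {p : Subset n} → 2 ≤ ∣ p ∣ → ∀ y → ∃ λ x → x ∈ p × x ≢ y
  ∃-∈-≢ {p = p} 2≤∣p∣ y with any? (λ x → x ∈? p ×-dec ¬? (x ≟ y))
  ... | yes found = found
  ... | no ∄x = ⊥-elim (<-irrefl refl (≤-trans 2≤∣p∣ (≤-trans (p⊆q⇒∣p∣≤∣q∣ p⊆⁅y⁆) (≤-reflexive (∣⁅x⁆∣≡1 y)))))
    where
    p⊆⁅y⁆ : p ⊆ ⁅ y ⁆
    p⊆⁅y⁆ {x} x∈p with x ≟ y
    ... | yes refl = x∈⁅x⁆ y
    ... | no x≢y = ⊥-elim (∄x (x , x∈p , x≢y))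

module FieldLemmas (F : FiniteField) where

  open import Data.Product.Base using (∃; _×_; _,_; proj₁; proj₂)
  open import Data.Sum.Base using (_⊎_; inj₁; inj₂)
  open import Relation.Nullary using (yes; no)

  open FiniteField F
  open import Algebra.Properties.AbelianGroup +-abelianGroup
    using (x∙y⁻¹≈ε⇒x≈y) renaming (∙-cancelˡ to +-cancelˡ; ∙-cancelʳ to +-cancelʳ)
  open import Algebra.Properties.Ring ring using (x[y-z]≈xy-xz)
  open import Algebra.Solver.Ring.NaturalCoefficients.Default commutativeSemiring
  open import Relation.Binary.Reasoning.Setoid setoid

  *-cancelˡ-≉0 : ∀ {w x y} → w ≉ 0# → w * x ≈ w * y → x ≈ y
  *-cancelˡ-≉0 {w} {x} {y} w≉0 wx≈wy = begin
    x              ≈⟨ sym (*-identityˡ x) ⟩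
    1# * x         ≈⟨ *-congʳ (sym w*w′≈1) ⟩
    (w * w′) * x   ≈⟨ reassoc w w′ x ⟩
    w′ * (w * x)   ≈⟨ *-congˡ wx≈wy ⟩
    w′ * (w * y)   ≈⟨ sym (reassoc w w′ y) ⟩
    (w * w′) * y   ≈⟨ *-congʳ w*w′≈1 ⟩
    1# * y         ≈⟨ *-identityˡ y ⟩
    y              ∎
    where
    w′ = proj₁ (inverse w w≉0)
    w*w′≈1 = proj₂ (inverse w w≉0)
    reassoc : ∀ a b c → (a * b) * c ≈ b * (a * c)
    reassoc = solve 3 (λ a b c → (a :* b) :* c := b :* (a :* c)) refl

  *-cancelʳ-≉0 : ∀ {w x y} → w ≉ 0# → x * w ≈ y * w → x ≈ y
  *-cancelʳ-≉0 {w} {x} {y} w≉0 xw≈yw = *-cancelˡ-≉0 w≉0 (trans (*-comm w x) (trans xw≈yw (*-comm y w)))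

  x*y≉0 : ∀ {x y} → x ≉ 0# → y ≉ 0# → x * y ≉ 0#
  x*y≉0 {x} {y} x≉0 y≉0 xy≈0 = y≉0 (*-cancelˡ-≉0 x≉0 (trans xy≈0 (sym (zeroʳ x))))

  x*y≉0⇒x≉0 : ∀ {x y} → x * y ≉ 0# → x ≉ 0#
  x*y≉0⇒x≉0 {x} {y} xy≉0 x≈0 = xy≉0 (trans (*-congʳ x≈0) (zeroˡ y))

  x*y≉0⇒y≉0 : ∀ {x y} → x * y ≉ 0# → y ≉ 0#
  x*y≉0⇒y≉0 {x} {y} xy≉0 y≈0 = xy≉0 (trans (*-congˡ y≈0) (zeroʳ x))

  x≉y⇒x-y≉0 : ∀ {x y} → x ≉ y → x - y ≉ 0#
  x≉y⇒x-y≉0 x≉y x-y≈0 = x≉y (x∙y⁻¹≈ε⇒x≈y _ _ x-y≈0)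

  x′+y≈x+y′⇒x-x′≈y-y′ : ∀ {x x′ y y′} → x′ + y ≈ x + y′ → x - x′ ≈ y - y′
  x′+y≈x+y′⇒x-x′≈y-y′ {x} {x′} {y} {y′} eq = +-cancelʳ (x′ + y′) _ _ (begin
    (x - x′) + (x′ + y′)    ≈⟨ shuffle x (- x′) x′ y′ ⟩
    (x + y′) + (- x′ + x′)  ≈⟨ +-cong (sym eq) (-‿inverseˡ x′) ⟩
    (x′ + y) + 0#           ≈⟨ +-congˡ (sym (-‿inverseˡ y′)) ⟩
    (x′ + y) + (- y′ + y′)  ≈⟨ shuffle′ x′ y (- y′) y′ ⟩
    (y - y′) + (x′ + y′)    ∎)
    where
    shuffle : ∀ a b c d → (a + b) + (c + d) ≈ (a + d) + (b + c)
    shuffle = solve 4 (λ a b c d → (a :+ b) :+ (c :+ d) := (a :+ d) :+ (b :+ c)) refl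
    shuffle′ : ∀ a b c d → (a + b) + (c + d) ≈ (b + c) + (a + d)
    shuffle′ = solve 4 (λ a b c d → (a :+ b) :+ (c :+ d) := (b :+ c) :+ (a :+ d)) refl

  -- The subtraction-free form of (α - β) (P - Q) ≈ 0.
  αQ+βP≈αP+βQ⇒α≈β⊎P≈Q : ∀ {α β P Q} → α * Q + β * P ≈ α * P + β * Q → α ≈ β ⊎ P ≈ Q
  αQ+βP≈αP+βQ⇒α≈β⊎P≈Q {α} {β} {P} {Q} eq with P ≟ Q
  ... | yes P≈Q = inj₂ P≈Q
  ... | no  P≉Q = inj₁ (*-cancelˡ-≉0 (x≉y⇒x-y≉0 P≉Q) (begin
    (P - Q) * α     ≈⟨ *-comm (P - Q) α ⟩
    α * (P - Q)     ≈⟨ x[y-z]≈xy-xz α P Q ⟩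
    α * P - α * Q   ≈⟨ x′+y≈x+y′⇒x-x′≈y-y′ eq ⟩
    β * P - β * Q   ≈⟨ sym (x[y-z]≈xy-xz β P Q) ⟩
    β * (P - Q)     ≈⟨ *-comm β (P - Q) ⟩
    (P - Q) * β     ∎))

  infix 7 _·_
  _·_ : Carrier × Carrier → Carrier × Carrier → Carrier
  (a₁ , a₂) · (x₁ , x₂) = a₁ * x₁ + a₂ * x₂

  Parallel : Carrier × Carrier → Carrier × Carrier → Set
  Parallel (x₁ , x₂) (y₁ , y₂) = x₁ * y₂ ≈ x₂ * y₁

  _≋_ : Carrier × Carrier → Carrier × Carrier → Set
  (x₁ , x₂) ≋ (y₁ , y₂) = x₁ ≈ y₁ × x₂ ≈ y₂

  ·-comm : ∀ u v → u · v ≈ v · u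
  ·-comm (a₁ , a₂) (x₁ , x₂) = +-cong (*-comm a₁ x₁) (*-comm a₂ x₂)

  parallel-on-line⇒≋ : ∀ {t w v v′} → t ≉ 0# → w · v ≈ t → w · v′ ≈ t → Parallel v v′ → v ≋ v′
  parallel-on-line⇒≋ {t} {w₁ , w₂} {x₁ , x₂} {y₁ , y₂} t≉0 wv≈t wv′≈t x₁y₂≈x₂y₁ =
    on-line (begin
      (w₁ * x₁ + w₂ * x₂) * y₁          ≈⟨ expand₁ w₁ w₂ x₁ x₂ y₁ ⟩
      w₁ * (x₁ * y₁) + w₂ * (x₂ * y₁)   ≈⟨ +-congˡ (*-congˡ (sym x₁y₂≈x₂y₁)) ⟩
      w₁ * (x₁ * y₁) + w₂ * (x₁ * y₂)   ≈⟨ expand₂ w₁ w₂ x₁ y₁ y₂ ⟩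
      x₁ * (w₁ * y₁ + w₂ * y₂)          ∎) ,
    on-line (begin
      (w₁ * x₁ + w₂ * x₂) * y₂          ≈⟨ expand₃ w₁ w₂ x₁ x₂ y₂ ⟩
      w₁ * (x₁ * y₂) + w₂ * (x₂ * y₂)   ≈⟨ +-congʳ (*-congˡ x₁y₂≈x₂y₁) ⟩
      w₁ * (x₂ * y₁) + w₂ * (x₂ * y₂)   ≈⟨ expand₄ w₁ w₂ x₂ y₁ y₂ ⟩
      x₂ * (w₁ * y₁ + w₂ * y₂)          ∎)
    where
    on-line : ∀ {a b} → (w₁ * x₁ + w₂ * x₂) * b ≈ a * (w₁ * y₁ + w₂ * y₂) → a ≈ b
    on-line {a} {b} eq = *-cancelˡ-≉0 t≉0 (begin
      t * a                             ≈⟨ *-comm t a ⟩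
      a * t                             ≈⟨ *-congˡ (sym wv′≈t) ⟩
      a * (w₁ * y₁ + w₂ * y₂)           ≈⟨ sym eq ⟩
      (w₁ * x₁ + w₂ * x₂) * b           ≈⟨ *-congʳ wv≈t ⟩
      t * b                             ∎)
    expand₁ : ∀ w₁ w₂ x₁ x₂ y₁ → (w₁ * x₁ + w₂ * x₂) * y₁ ≈ w₁ * (x₁ * y₁) + w₂ * (x₂ * y₁)
    expand₁ = solve 5 (λ w₁ w₂ x₁ x₂ y₁ → (w₁ :* x₁ :+ w₂ :* x₂) :* y₁ := w₁ :* (x₁ :* y₁) :+ w₂ :* (x₂ :* y₁)) refl
    expand₂ : ∀ w₁ w₂ x₁ y₁ y₂ → w₁ * (x₁ * y₁) + w₂ * (x₁ * y₂) ≈ x₁ * (w₁ * y₁ + w₂ * y₂)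
    expand₂ = solve 5 (λ w₁ w₂ x₁ y₁ y₂ → w₁ :* (x₁ :* y₁) :+ w₂ :* (x₁ :* y₂) := x₁ :* (w₁ :* y₁ :+ w₂ :* y₂)) refl
    expand₃ : ∀ w₁ w₂ x₁ x₂ y₂ → (w₁ * x₁ + w₂ * x₂) * y₂ ≈ w₁ * (x₁ * y₂) + w₂ * (x₂ * y₂)
    expand₃ = solve 5 (λ w₁ w₂ x₁ x₂ y₂ → (w₁ :* x₁ :+ w₂ :* x₂) :* y₂ := w₁ :* (x₁ :* y₂) :+ w₂ :* (x₂ :* y₂)) refl
    expand₄ : ∀ w₁ w₂ x₂ y₁ y₂ → w₁ * (x₂ * y₁) + w₂ * (x₂ * y₂) ≈ x₂ * (w₁ * y₁ + w₂ * y₂)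
    expand₄ = solve 5 (λ w₁ w₂ x₂ y₁ y₂ → w₁ :* (x₂ :* y₁) :+ w₂ :* (x₂ :* y₂) := x₂ :* (w₁ :* y₁ :+ w₂ :* y₂)) refl

  -- (u · v) (u′ · v′) - (u · v′) (u′ · v) = det (u , u′) det (v , v′), with the negative terms moved across.
  cauchy-binet : ∀ a₁ a₂ b₁ b₂ x₁ x₂ y₁ y₂ →
    ((a₁ , a₂) · (x₁ , x₂)) * ((b₁ , b₂) · (y₁ , y₂)) + ((a₁ * b₂) * (x₂ * y₁) + (a₂ * b₁) * (x₁ * y₂)) ≈
    ((a₁ , a₂) · (y₁ , y₂)) * ((b₁ , b₂) · (x₁ , x₂)) + ((a₁ * b₂) * (x₁ * y₂) + (a₂ * b₁) * (x₂ * y₁))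
  cauchy-binet = solve 8 (λ a₁ a₂ b₁ b₂ x₁ x₂ y₁ y₂ →
    (a₁ :* x₁ :+ a₂ :* x₂) :* (b₁ :* y₁ :+ b₂ :* y₂) :+ ((a₁ :* b₂) :* (x₂ :* y₁) :+ (a₂ :* b₁) :* (x₁ :* y₂)) :=
    (a₁ :* y₁ :+ a₂ :* y₂) :* (b₁ :* x₁ :+ b₂ :* x₂) :+ ((a₁ :* b₂) :* (x₁ :* y₂) :+ (a₂ :* b₁) :* (x₂ :* y₁))) refl

  lines-meet-once : ∀ {t u u′ v v′} → t ≉ 0# → u · v ≈ t → u · v′ ≈ t → u′ · v ≈ t → u′ · v′ ≈ t → v ≋ v′ ⊎ u ≋ u′
  lines-meet-once {t} {a₁ , a₂} {b₁ , b₂} {x₁ , x₂} {y₁ , y₂} t≉0 uv uv′ u′v u′v′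
    with αQ+βP≈αP+βQ⇒α≈β⊎P≈Q (+-cancelˡ _ _ _ (begin
      (u · v) * (u′ · v′) + ((a₁ * b₂) * (x₂ * y₁) + (a₂ * b₁) * (x₁ * y₂)) ≈⟨ cauchy-binet a₁ a₂ b₁ b₂ x₁ x₂ y₁ y₂ ⟩
      (u · v′) * (u′ · v) + ((a₁ * b₂) * (x₁ * y₂) + (a₂ * b₁) * (x₂ * y₁)) ≈⟨ +-congʳ (trans (*-cong uv′ u′v) (sym (*-cong uv u′v′))) ⟩
      (u · v) * (u′ · v′) + ((a₁ * b₂) * (x₁ * y₂) + (a₂ * b₁) * (x₂ * y₁)) ∎))
    where u = (a₁ , a₂) ; u′ = (b₁ , b₂) ; v = (x₁ , x₂) ; v′ = (y₁ , y₂)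
  ... | inj₁ u∥u′ = inj₂ (parallel-on-line⇒≋ t≉0 (trans (·-comm _ _) uv) (trans (·-comm _ _) u′v) u∥u′)
  ... | inj₂ v∥v′ = inj₁ (parallel-on-line⇒≋ t≉0 uv uv′ v∥v′)

  affine-solution : ∀ {a} → a ≉ 0# → ∀ w t → ∃ λ x → a * x + w ≈ t
  affine-solution {a} a≉0 w t = a′ * (t - w) , (begin
    a * (a′ * (t - w)) + w  ≈⟨ +-congʳ (sym (*-assoc a a′ (t - w))) ⟩
    (a * a′) * (t - w) + w  ≈⟨ +-congʳ (*-congʳ (proj₂ (inverse a a≉0))) ⟩
    1# * (t - w) + w        ≈⟨ +-congʳ (*-identityˡ (t - w)) ⟩
    (t - w) + w             ≈⟨ +-assoc t (- w) w ⟩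
    t + (- w + w)           ≈⟨ +-congˡ (-‿inverseˡ w) ⟩
    t + 0#                  ≈⟨ +-identityʳ t ⟩
    t                       ∎)
    where a′ = proj₁ (inverse a a≉0)

  affine-unique : ∀ {a w t x y} → a ≉ 0# → a * x + w ≈ t → a * y + w ≈ t → x ≈ y
  affine-unique {w = w} a≉0 ax+w≈t ay+w≈t = *-cancelˡ-≉0 a≉0 (+-cancelʳ w _ _ (trans ax+w≈t (sym ay+w≈t)))

  double : ∀ x → (1# + 1#) * x ≈ x + x
  double = solve 1 (λ x → (con 1 :+ con 1) :* x := x :+ x) refl

  x+y≈2c∧x≈c⇒y≈c : ∀ {x y c} → x + y ≈ (1# + 1#) * c → x ≈ c → y ≈ c
  x+y≈2c∧x≈c⇒y≈c {x} {y} {c} x+y≈2c x≈c = +-cancelˡ c _ _ (begin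
    c + y              ≈⟨ +-congʳ (sym x≈c) ⟩
    x + y              ≈⟨ x+y≈2c ⟩
    (1# + 1#) * c      ≈⟨ double c ⟩
    c + c              ∎)

module Incidences (F : FiniteField) where

  open import Data.Nat.Base using (ℕ; z≤n)
  open import Data.Fin.Base using (Fin)
  open import Data.Integer.Base using (ℤ; +_; +≤+; 0ℤ; 1ℤ; _+_; _*_; -_; _-_; _≤_; _<_)
  open import Data.Integer.Properties
    using (+-*-semiring; +-identityˡ; *-identityʳ; *-zeroˡ; *-zeroʳ; *-comm; +-monoʳ-≤; i≤i+j; ≤-trans; ≤-reflexive; module ≤-Reasoning)
  open import Data.Integer.Tactic.RingSolver using (solve-∀)
  open import Data.Product.Base using (_×_; _,_; proj₁; proj₂)
  open import Data.Sum.Base using (inj₁; inj₂)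
  open import Relation.Nullary using (Dec; yes; no; contradiction; _×-dec_)
  open import Relation.Binary.PropositionalEquality using (_≡_; _≢_; refl; sym; trans; cong; cong₂; module ≡-Reasoning)
  open import Algebra.Properties.Semiring.Sum +-*-semiring using (sum-syntax; ∑-comm; sum-cong-≗)
  open FiniteSums
  open IntegerInequalities using (square-nonneg; *-nonneg; *-monoˡ-≤-0≤)

  open FiniteField F using (Carrier; _≈_; _≉_; _≟_; 0#; enum; enum-inj; enum-surj; size; zeroˡ)
    renaming (_+_ to _+ᶠ_; _*_ to _*ᶠ_; sym to ≈-sym; trans to ≈-trans; refl to ≈-refl; +-cong to +ᶠ-cong; *-cong to *ᶠ-cong; +-identityʳ to +ᶠ-identityʳ; +-comm to +ᶠ-comm)
  open FieldLemmas F

  q : ℕ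
  q = size

  Point : Set
  Point = Fin q × Fin q

  vec : Point → Carrier × Carrier
  vec (i , i′) = enum i , enum i′

  vec-injective : ∀ {u v} → vec u ≋ vec v → u ≡ v
  vec-injective {i , i′} {j , j′} (eᵢ≈eⱼ , eᵢ′≈eⱼ′) = cong₂ _,_ (enum-inj i j eᵢ≈eⱼ) (enum-inj i′ j′ eᵢ′≈eⱼ′)

  -- A point u ≢ origin stands for the line {v : vec u · vec v ≈ t}.
  incidence : Carrier → Point → Point → ℤ
  incidence t u v = 𝟙 ((vec u · vec v) ≟ t)

  zeroIndex : Fin q
  zeroIndex = proj₁ (enum-surj 0#)

  origin : Point
  origin = zeroIndex , zeroIndex

  enum-zeroIndex : enum zeroIndex ≈ 0#
  enum-zeroIndex = proj₂ (enum-surj 0#)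

  enum≈0⇒≡zeroIndex : ∀ {i} → enum i ≈ 0# → i ≡ zeroIndex
  enum≈0⇒≡zeroIndex {i} eᵢ≈0 = enum-inj i zeroIndex (≈-trans eᵢ≈0 (≈-sym enum-zeroIndex))

  count-affine : ∀ {a} → a ≉ 0# → ∀ w t → ∑[ j < q ] 𝟙 ((a *ᶠ enum j +ᶠ w) ≟ t) ≡ 1ℤ
  count-affine {a} a≉0 w t = ∑-𝟙-unique (λ j → (a *ᶠ enum j +ᶠ w) ≟ t) j₀ j₀-solves
    (λ j j-solves → enum-inj j j₀ (affine-unique a≉0 j-solves j₀-solves))
    where
    x = proj₁ (affine-solution a≉0 w t)
    j₀ = proj₁ (enum-surj x)
    j₀-solves : a *ᶠ enum j₀ +ᶠ w ≈ t
    j₀-solves = ≈-trans (+ᶠ-cong (*ᶠ-cong ≈-refl (proj₂ (enum-surj x))) ≈-refl) (proj₂ (affine-solution a≉0 w t))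

  line-size : ∀ {t} → t ≉ 0# → ∀ {u} → u ≢ origin → ∑² (incidence t u) ≡ + q
  line-size {t} t≉0 {i , i′} u≢origin with enum i ≟ 0#
  ... | no eᵢ≉0 = begin
    ∑[ j < q ] ∑[ j′ < q ] 𝟙 ((enum i *ᶠ enum j +ᶠ enum i′ *ᶠ enum j′) ≟ t)
      ≡⟨ ∑-comm (λ j j′ → 𝟙 ((enum i *ᶠ enum j +ᶠ enum i′ *ᶠ enum j′) ≟ t)) ⟩
    ∑[ j′ < q ] ∑[ j < q ] 𝟙 ((enum i *ᶠ enum j +ᶠ enum i′ *ᶠ enum j′) ≟ t)
      ≡⟨ sum-cong-≗ (λ j′ → count-affine eᵢ≉0 (enum i′ *ᶠ enum j′) t) ⟩
    ∑[ j′ < q ] 1ℤ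
      ≡⟨ trans (∑-const q 1ℤ) (*-identityʳ (+ q)) ⟩
    + q ∎
    where open ≡-Reasoning
  ... | yes eᵢ≈0 = begin
    ∑[ j < q ] ∑[ j′ < q ] 𝟙 ((enum i *ᶠ enum j +ᶠ enum i′ *ᶠ enum j′) ≟ t)
      ≡⟨ sum-cong-≗ {q} (λ j → sum-cong-≗ {q} λ j′ → 𝟙-cong (_ ≟ t) (_ ≟ t) (≈-trans (+ᶠ-comm _ _)) (≈-trans (+ᶠ-comm _ _))) ⟩
    ∑[ j < q ] ∑[ j′ < q ] 𝟙 ((enum i′ *ᶠ enum j′ +ᶠ enum i *ᶠ enum j) ≟ t)
      ≡⟨ sum-cong-≗ (λ j → count-affine eᵢ′≉0 (enum i *ᶠ enum j) t) ⟩
    ∑[ j < q ] 1ℤ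
      ≡⟨ trans (∑-const q 1ℤ) (*-identityʳ (+ q)) ⟩
    + q ∎
    where
    open ≡-Reasoning
    eᵢ′≉0 : enum i′ ≉ 0#
    eᵢ′≉0 eᵢ′≈0 = u≢origin (cong₂ _,_ (enum≈0⇒≡zeroIndex eᵢ≈0) (enum≈0⇒≡zeroIndex eᵢ′≈0))

  origin-off-line : ∀ {t} → t ≉ 0# → ∀ v → incidence t origin v ≡ 0ℤ
  origin-off-line t≉0 (j , j′) = 𝟙-no _ λ o·v≈t → t≉0 (≈-trans (≈-sym o·v≈t) o·v≈0)
    where
    o·v≈0 : vec origin · vec (j , j′) ≈ 0#
    o·v≈0 = ≈-trans (+ᶠ-cong (≈-trans (*ᶠ-cong enum-zeroIndex ≈-refl) (zeroˡ _)) (≈-trans (*ᶠ-cong enum-zeroIndex ≈-refl) (zeroˡ _))) (+ᶠ-identityʳ 0#)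

  line-size-≤ : ∀ {t} → t ≉ 0# → ∀ u → ∑² (incidence t u) ≤ + q
  line-size-≤ t≉0 u with u ≟² origin
  ... | yes refl = ≤-trans (≤-reflexive (trans (∑²-cong (origin-off-line t≉0)) (∑²-zero q q))) (+≤+ z≤n)
  ... | no u≢origin = ≤-reflexive (line-size t≉0 u≢origin)

  two-lines-bound : ∀ {t} → t ≉ 0# → ∀ u u′ →
    ∑² (λ v → incidence t u v * incidence t u′ v) ≤ + q * 𝟙 (u ≟² u′) + 1ℤ
  two-lines-bound {t} t≉0 u u′ with u ≟² u′
  ... | yes refl = begin
    ∑² (λ v → incidence t u v * incidence t u v) ≡⟨ ∑²-cong (λ v → 𝟙-idem ((vec u · vec v) ≟ t)) ⟩
    ∑² (incidence t u)                           ≤⟨ line-size-≤ t≉0 u ⟩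
    + q                                          ≡⟨ sym (*-identityʳ (+ q)) ⟩
    + q * 1ℤ                                     ≤⟨ i≤i+j (+ q * 1ℤ) 1ℤ ⟩
    + q * 1ℤ + 1ℤ                                ∎
    where open ≤-Reasoning
  ... | no u≢u′ = begin
    ∑² (λ v → incidence t u v * incidence t u′ v) ≡⟨ ∑²-cong (λ v → sym (𝟙-× (on-line u v) (on-line u′ v))) ⟩
    ∑² (λ v → 𝟙 (on-line u v ×-dec on-line u′ v)) ≤⟨ ∑²-𝟙-atMostOne (λ v → on-line u v ×-dec on-line u′ v) common-point-unique ⟩
    1ℤ                                            ≡⟨ sym (+-identityˡ 1ℤ) ⟩
    0ℤ + 1ℤ                                       ≡⟨ cong (_+ 1ℤ) (sym (*-zeroʳ (+ q))) ⟩
    + q * 0ℤ + 1ℤ                                 ∎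
    where
    open ≤-Reasoning
    on-line : ∀ u v → Dec (vec u · vec v ≈ t)
    on-line u v = (vec u · vec v) ≟ t
    common-point-unique : ∀ v v′ → (vec u · vec v ≈ t × vec u′ · vec v ≈ t) → (vec u · vec v′ ≈ t × vec u′ · vec v′ ≈ t) → v ≡ v′
    common-point-unique v v′ (uv , u′v) (uv′ , u′v′) with lines-meet-once t≉0 uv uv′ u′v u′v′
    ... | inj₁ v≋v′ = vec-injective v≋v′
    ... | inj₂ u≋u′ = contradiction (vec-injective u≋u′) u≢u′

  module Moments {t} (t≉0 : t ≉ 0#) (W : Point → ℤ) where

    degree : Point → ℤ
    degree v = ∑² λ u → W u * incidence t u v

    first-moment : W origin ≡ 0ℤ → ∑² degree ≡ + q * ∑² W
    first-moment W-origin = begin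
      ∑² (λ v → ∑² λ u → W u * incidence t u v) ≡⟨ ∑²-comm (λ v u → W u * incidence t u v) ⟩
      ∑² (λ u → ∑² λ v → W u * incidence t u v) ≡⟨ ∑²-cong (λ u → sym (*-distribˡ-∑² (W u) (incidence t u))) ⟩
      ∑² (λ u → W u * ∑² (incidence t u))       ≡⟨ ∑²-cong weighted-line-size ⟩
      ∑² (λ u → + q * W u)                      ≡⟨ *-distribˡ-∑² (+ q) W ⟨
      + q * ∑² W                                ∎
      where
      open ≡-Reasoning
      weighted-line-size : ∀ u → W u * ∑² (incidence t u) ≡ + q * W u
      weighted-line-size u with u ≟² origin
      ... | yes refl rewrite W-origin = trans (*-zeroˡ (∑² (incidence t origin))) (sym (*-zeroʳ (+ q)))
      ... | no u≢origin = trans (cong (W u *_) (line-size t≉0 u≢origin)) (*-comm (W u) (+ q))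

    split-diagonal : ∑² (λ u → ∑² λ u′ → (W u * W u′) * (+ q * 𝟙 (u ≟² u′) + 1ℤ))
                   ≡ + q * ∑² (λ u → W u * W u) + ∑² W * ∑² W
    split-diagonal = begin
      ∑² (λ u → ∑² λ u′ → (W u * W u′) * (+ q * 𝟙 (u ≟² u′) + 1ℤ))
        ≡⟨ ∑²-cong (λ u → ∑²-cong λ u′ → expand (W u) (W u′) (𝟙 (u ≟² u′))) ⟩
      ∑² (λ u → ∑² λ u′ → + q * (W u * (𝟙 (u ≟² u′) * W u′)) + W u * W u′)
        ≡⟨ ∑²-cong (λ u → ∑²-distrib-+ (λ u′ → + q * (W u * (𝟙 (u ≟² u′) * W u′))) (λ u′ → W u * W u′)) ⟩
      ∑² (λ u → ∑² (λ u′ → + q * (W u * (𝟙 (u ≟² u′) * W u′))) + ∑² (λ u′ → W u * W u′))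
        ≡⟨ ∑²-distrib-+ (λ u → ∑² (λ u′ → + q * (W u * (𝟙 (u ≟² u′) * W u′)))) (λ u → ∑² (λ u′ → W u * W u′)) ⟩
      ∑² (λ u → ∑² (λ u′ → + q * (W u * (𝟙 (u ≟² u′) * W u′)))) + ∑² (λ u → ∑² (λ u′ → W u * W u′))
        ≡⟨ cong₂ _+_ (trans (∑²-cong diagonal) (sym (*-distribˡ-∑² (+ q) (λ u → W u * W u)))) (sym (∑²-*-∑² W W)) ⟩
      + q * ∑² (λ u → W u * W u) + ∑² W * ∑² W ∎
      where
      open ≡-Reasoning
      expand : ∀ a b d → (a * b) * (+ q * d + 1ℤ) ≡ + q * (a * (d * b)) + a * b
      expand a b d = expand-Q a b d (+ q)
        where
        expand-Q : ∀ a b d Q → (a * b) * (Q * d + 1ℤ) ≡ Q * (a * (d * b)) + a * b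
        expand-Q = solve-∀
      diagonal : ∀ u → ∑² (λ u′ → + q * (W u * (𝟙 (u ≟² u′) * W u′))) ≡ + q * (W u * W u)
      diagonal u = begin
        ∑² (λ u′ → + q * (W u * (𝟙 (u ≟² u′) * W u′))) ≡⟨ *-distribˡ-∑² (+ q) (λ u′ → W u * (𝟙 (u ≟² u′) * W u′)) ⟨
        + q * ∑² (λ u′ → W u * (𝟙 (u ≟² u′) * W u′))   ≡⟨ cong (_*_ (+ q)) (*-distribˡ-∑² (W u) (λ u′ → 𝟙 (u ≟² u′) * W u′)) ⟨
        + q * (W u * ∑² (λ u′ → 𝟙 (u ≟² u′) * W u′))   ≡⟨ cong (λ x → + q * (W u * x)) (∑²-delta u W) ⟩
        + q * (W u * W u)                             ∎

    second-moment : (∀ u → 0ℤ ≤ W u) →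
      ∑² (λ v → degree v * degree v) ≤ + q * ∑² (λ u → W u * W u) + ∑² W * ∑² W
    second-moment W≥0 = begin
      ∑² (λ v → degree v * degree v)
        ≡⟨ ∑²-cong (λ v → ∑²-*-∑² (λ u → W u * incidence t u v) (λ u′ → W u′ * incidence t u′ v)) ⟩
      ∑² (λ v → ∑² λ u → ∑² λ u′ → (W u * incidence t u v) * (W u′ * incidence t u′ v))
        ≡⟨ ∑²-comm (λ v u → ∑² λ u′ → (W u * incidence t u v) * (W u′ * incidence t u′ v)) ⟩
      ∑² (λ u → ∑² λ v → ∑² λ u′ → (W u * incidence t u v) * (W u′ * incidence t u′ v))
        ≡⟨ ∑²-cong (λ u → ∑²-comm λ v u′ → (W u * incidence t u v) * (W u′ * incidence t u′ v)) ⟩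
      ∑² (λ u → ∑² λ u′ → ∑² λ v → (W u * incidence t u v) * (W u′ * incidence t u′ v))
        ≡⟨ ∑²-cong (λ u → ∑²-cong λ u′ → pull-weights u u′) ⟩
      ∑² (λ u → ∑² λ u′ → (W u * W u′) * ∑² (λ v → incidence t u v * incidence t u′ v))
        ≤⟨ ∑²-mono (λ u → ∑²-mono λ u′ → *-monoˡ-≤-0≤ (*-nonneg (W≥0 u) (W≥0 u′)) (two-lines-bound t≉0 u u′)) ⟩
      ∑² (λ u → ∑² λ u′ → (W u * W u′) * (+ q * 𝟙 (u ≟² u′) + 1ℤ))
        ≡⟨ split-diagonal ⟩
      + q * ∑² (λ u → W u * W u) + ∑² W * ∑² W ∎
      where
      open ≤-Reasoning
      pull-weights : ∀ u u′ → ∑² (λ v → (W u * incidence t u v) * (W u′ * incidence t u′ v))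
                            ≡ (W u * W u′) * ∑² (λ v → incidence t u v * incidence t u′ v)
      pull-weights u u′ = trans (∑²-cong λ v → interchange (W u) (incidence t u v) (W u′) (incidence t u′ v))
                                (sym (*-distribˡ-∑² (W u * W u′) (λ v → incidence t u v * incidence t u′ v)))
        where
        interchange : ∀ a x b y → (a * x) * (b * y) ≡ (a * b) * (x * y)
        interchange = solve-∀

    variance : W origin ≡ 0ℤ → (∀ u → 0ℤ ≤ W u) →
      ∑² (λ v → (∑² W - + q * degree v) * (∑² W - + q * degree v)) ≤ + q * (+ q * (+ q * ∑² (λ u → W u * W u)))
    variance W-origin W≥0 = begin
      ∑² (λ v → (K - Q * degree v) * (K - Q * degree v))
        ≡⟨ ∑²-cong (λ v → square-expansion K Q (degree v)) ⟩
      ∑² (λ v → (K * K) * 1ℤ + (- (K * Q + K * Q) * degree v + (Q * Q) * (degree v * degree v)))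
        ≡⟨ ∑²-linear₃ (K * K) (- (K * Q + K * Q)) (Q * Q) (λ (_ : Point) → 1ℤ) degree (λ v → degree v * degree v) ⟩
      (K * K) * ∑² (λ (_ : Point) → 1ℤ) + (- (K * Q + K * Q) * ∑² degree + (Q * Q) * ∑² (λ v → degree v * degree v))
        ≡⟨ cong₂ (λ x y → (K * K) * x + (- (K * Q + K * Q) * y + (Q * Q) * ∑² (λ v → degree v * degree v)))
                 (∑²-const q q 1ℤ) (first-moment W-origin) ⟩
      (K * K) * (Q * (Q * 1ℤ)) + (- (K * Q + K * Q) * (Q * K) + (Q * Q) * ∑² (λ v → degree v * degree v))
        ≤⟨ +-monoʳ-≤ ((K * K) * (Q * (Q * 1ℤ))) (+-monoʳ-≤ (- (K * Q + K * Q) * (Q * K))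
             (*-monoˡ-≤-0≤ (square-nonneg Q) (second-moment W≥0))) ⟩
      (K * K) * (Q * (Q * 1ℤ)) + (- (K * Q + K * Q) * (Q * K) + (Q * Q) * (Q * S + K * K))
        ≡⟨ collect K Q S ⟩
      Q * (Q * (Q * S)) ∎
      where
      open ≤-Reasoning
      K = ∑² W
      S = ∑² (λ u → W u * W u)
      Q = + q
      square-expansion : ∀ k Q d → (k - Q * d) * (k - Q * d) ≡ (k * k) * 1ℤ + (- (k * Q + k * Q) * d + (Q * Q) * (d * d))
      square-expansion = solve-∀
      collect : ∀ k Q s → (k * k) * (Q * (Q * 1ℤ)) + (- (k * Q + k * Q) * (Q * k) + (Q * Q) * (Q * s + k * k)) ≡ Q * (Q * (Q * s))
      collect = solve-∀

    incidence-bound : W origin ≡ 0ℤ → (∀ u → 0ℤ ≤ W u) → (U : Point → ℤ) → 0ℤ < ∑² (λ v → U v * U v) →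
      let D = ∑² W * ∑² U - + q * ∑² (λ v → U v * degree v) in
      D * D ≤ ∑² (λ v → U v * U v) * (+ q * (+ q * (+ q * ∑² (λ u → W u * W u))))
    incidence-bound W-origin W≥0 U 0<∑U² = begin
      D * D                                                       ≡⟨ cong₂ _*_ (sym deviation) (sym deviation) ⟩
      ∑² (λ v → U v * g v) * ∑² (λ v → U v * g v)                 ≤⟨ cauchy-schwarz U g 0<∑U² ⟩
      ∑² (λ v → U v * U v) * ∑² (λ v → g v * g v)                 ≤⟨ *-monoˡ-≤-0≤ (∑²-nonneg λ v → square-nonneg (U v)) (variance W-origin W≥0) ⟩
      ∑² (λ v → U v * U v) * (Q * (Q * (Q * ∑² (λ u → W u * W u)))) ∎
      where
      open ≤-Reasoning
      K = ∑² W
      Q = + q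
      D = K * ∑² U - Q * ∑² (λ v → U v * degree v)
      g : Point → ℤ
      g v = K - Q * degree v
      deviation : ∑² (λ v → U v * g v) ≡ D
      deviation = begin-equality
        ∑² (λ v → U v * g v)                                 ≡⟨ ∑²-cong (λ v → distribute (U v) K Q (degree v)) ⟩
        ∑² (λ v → K * U v + (- Q) * (U v * degree v))         ≡⟨ ∑²-linear₂ K (- Q) U (λ v → U v * degree v) ⟩
        K * ∑² U + (- Q) * ∑² (λ v → U v * degree v)          ≡⟨ regroup K (∑² U) Q (∑² (λ v → U v * degree v)) ⟩
        D                                                    ∎
        where
        distribute : ∀ u k Q d → u * (k - Q * d) ≡ k * u + (- Q) * (u * d)
        distribute = solve-∀
        regroup : ∀ k s Q n → k * s + (- Q) * n ≡ k * s - Q * n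
        regroup = solve-∀

module NumericContradiction where

  open import Data.Integer.Base using (+_; 0ℤ; 1ℤ; _+_; _*_; -_; _-_; _≤_; _<_; +<+)
  open import Data.Integer.Properties
    using (<-irrefl; <-≤-trans; ≤-<-trans; <⇒≤; ≤-refl; ≤-reflexive; ≤-trans; i≤j⇒0≤j-i; +-mono-≤; +-monoʳ-≤;
           +-identityʳ; *-comm; pos-*; m-n≡m⊖n; ⊖-≥; module ≤-Reasoning)
  open import Data.Integer.Tactic.RingSolver using (solve-∀)
  import Data.Nat.Base as ℕ
  import Data.Nat.Properties as ℕ
  open import Data.Nat.Base using (suc; z≤n; s≤s)
  open import Data.Sum.Base using (_⊎_; inj₁; inj₂)
  open import Relation.Nullary using (¬_; contradiction)
  open import Relation.Binary.PropositionalEquality using (_≡_; refl; sym; trans; cong; cong₂; subst₂)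
  open IntegerInequalities

  -- With m = a b - Q, for z = 1 the right side exceeds the left one by m b + (Q - b) (2 m + b).
  shifted-square-bound : ∀ {Q a b z} → z ≡ 0ℤ ⊎ z ≡ 1ℤ → 0ℤ ≤ b → b ≤ Q → 0ℤ ≤ a * b - Q →
    (a + z) * ((a * b - Q) * (a * b - Q)) ≤ (a - z) * ((a * b - Q + z * b) * (a * b - Q + z * b))
  shifted-square-bound {Q} {a} {b} (inj₁ refl) _ _ _ = ≤-reflexive (unshifted Q a b)
    where
    unshifted : ∀ Q a b → (a + 0ℤ) * ((a * b - Q) * (a * b - Q)) ≡ (a - 0ℤ) * ((a * b - Q + 0ℤ * b) * (a * b - Q + 0ℤ * b))
    unshifted = solve-∀
  shifted-square-bound {Q} {a} {b} (inj₂ refl) 0≤b b≤Q 0≤m =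
    ≤-by-gap ((a * b - Q) * b + (Q - b) * ((a * b - Q) + (a * b - Q) + b)) (gap Q a b)
      (+-mono-≤ (*-nonneg 0≤m 0≤b) (*-nonneg (i≤j⇒0≤j-i b≤Q) (+-mono-≤ (+-mono-≤ 0≤m 0≤m) 0≤b)))
    where
    gap : ∀ Q a b → (a - 1ℤ) * ((a * b - Q + 1ℤ * b) * (a * b - Q + 1ℤ * b)) - (a + 1ℤ) * ((a * b - Q) * (a * b - Q))
                  ≡ (a * b - Q) * b + (Q - b) * ((a * b - Q) + (a * b - Q) + b)
    gap = solve-∀

  density-contradiction : ∀ {Q a b z R N} → z ≡ 0ℤ ⊎ z ≡ 1ℤ → + 2 ≤ a → 0ℤ < b → b ≤ Q → Q < a * b →
    Q * (Q * Q) < (a * b - Q) * (a * b - Q) → 0ℤ ≤ R → R ≤ a - z → R ≤ b → N ≤ R * R →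
    ¬ (((a * a - z * z) * (b * b) - Q * N) * ((a * a - z * z) * (b * b) - Q * N)
        ≤ (b * b) * (Q * (Q * (Q * (a * a - z * z)))))
  density-contradiction {Q} {a} {b} {z} {R} {N} z∈01 2≤a 0<b b≤Q Q<ab Q³<m² 0≤R R≤a-z R≤b N≤R² X²≤bound =
    <-irrefl refl (begin-strict
      (b * b) * (Q * (Q * (Q * (a * a - z * z)))) ≡⟨ bound≡ Q a b z ⟩
      c * ((a + z) * (Q * (Q * Q)))                  <⟨ *-monoˡ-<-0< 0<c (<-≤-trans (*-monoˡ-<-0< 0<a+z Q³<m²)
                                                          (shifted-square-bound {Q} {a} {b} z∈01 0≤b b≤Q (<⇒≤ 0<m))) ⟩
      c * ((a - z) * ((m + z * b) * (m + z * b)))    ≡⟨ Y²≡ Q a b z ⟨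
      Y * Y                                          ≤⟨ square-mono-≤ 0≤Y Y≤X ⟩
      X * X                                          ≤⟨ X²≤bound ⟩
      (b * b) * (Q * (Q * (Q * (a * a - z * z)))) ∎)
    where
    open ≤-Reasoning
    m = a * b - Q
    X = (a * a - z * z) * (b * b) - Q * N
    Y = ((a - z) * b) * (m + z * b)
    c = (b * b) * (a - z)
    0≤b = <⇒≤ 0<b
    0≤z = bit-nonneg z∈01
    0<m = <⇒0<- Q<ab
    0<a = <-≤-trans (+<+ (s≤s z≤n)) 2≤a
    0<a-z = <⇒0<- (≤-<-trans (bit-≤1 z∈01) (<-≤-trans (+<+ (s≤s (s≤s z≤n))) 2≤a))
    0<a+z = <-≤-trans 0<a (≤-trans (≤-reflexive (sym (+-identityʳ a))) (+-monoʳ-≤ a 0≤z))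
    0<c = *-pos (*-pos 0<b 0<b) 0<a-z
    0≤Y : 0ℤ ≤ Y
    0≤Y = *-nonneg (*-nonneg (<⇒≤ 0<a-z) 0≤b) (+-mono-≤ (<⇒≤ 0<m) (*-nonneg 0≤z 0≤b))
    N≤[a-z]b : N ≤ (a - z) * b
    N≤[a-z]b = ≤-trans N≤R² (≤-trans (*-monoˡ-≤-0≤ 0≤R R≤b)
                 (subst₂ _≤_ (*-comm b R) (*-comm b (a - z)) (*-monoˡ-≤-0≤ 0≤b R≤a-z)))
    Y≤X : Y ≤ X
    Y≤X = ≤-by-gap (Q * ((a - z) * b) - Q * N) (gap Q a b z N)
            (i≤j⇒0≤j-i (*-monoˡ-≤-0≤ (≤-trans 0≤b b≤Q) N≤[a-z]b))
      where
      gap : ∀ Q a b z N → ((a * a - z * z) * (b * b) - Q * N) - ((a - z) * b) * ((a * b - Q) + z * b)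
                        ≡ Q * ((a - z) * b) - Q * N
      gap = solve-∀
    bound≡ : ∀ Q a b z → (b * b) * (Q * (Q * (Q * (a * a - z * z)))) ≡ ((b * b) * (a - z)) * ((a + z) * (Q * (Q * Q)))
    bound≡ = solve-∀
    Y²≡ : ∀ Q a b z → (((a - z) * b) * ((a * b - Q) + z * b)) * (((a - z) * b) * ((a * b - Q) + z * b))
                    ≡ ((b * b) * (a - z)) * ((a - z) * (((a * b - Q) + z * b) * ((a * b - Q) + z * b)))
    Y²≡ = solve-∀

  2≤-factor : ∀ {q m n} → q ℕ.< m ℕ.* n → n ℕ.≤ q → 2 ℕ.≤ m
  2≤-factor {m = 0}           q<0   _   = contradiction q<0 ℕ.n≮0
  2≤-factor {q} {m = 1} {n}   q<1*n n≤q = contradiction (ℕ.<-≤-trans q<1*n (ℕ.≤-trans (ℕ.≤-reflexive (ℕ.+-identityʳ n)) n≤q)) (ℕ.<-irrefl refl)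
  2≤-factor {m = suc (suc _)} _     _   = s≤s (s≤s z≤n)

  cube<square-ℤ : ∀ {q n} → q ℕ.< n → q ℕ.^ 3 ℕ.< (n ℕ.∸ q) ℕ.^ 2 → + q * (+ q * + q) < (+ n - + q) * (+ n - + q)
  cube<square-ℤ {q} {n} q<n q³<d² = subst₂ _<_ (cube q) (trans (square (n ℕ.∸ q)) (cong₂ _*_ difference difference)) (+<+ q³<d²)
    where
    cube : ∀ x → + (x ℕ.^ 3) ≡ + x * (+ x * + x)
    cube x = trans (cong (λ y → + (x ℕ.* (x ℕ.* y))) (ℕ.*-identityʳ x)) (trans (pos-* x (x ℕ.* x)) (cong (+ x *_) (pos-* x x)))
    square : ∀ x → + (x ℕ.^ 2) ≡ + x * + x
    square x = trans (cong (λ y → + (x ℕ.* y)) (ℕ.*-identityʳ x)) (pos-* x x)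
    difference : + (n ℕ.∸ q) ≡ + n - + q
    difference = sym (trans (m-n≡m⊖n n q) (⊖-≥ (ℕ.<⇒≤ q<n)))

module ProductSets (F : FiniteField) (A B : Subset (FiniteField.size F)) where

  import Data.Nat.Base as ℕ
  import Data.Nat.Properties as ℕ
  open import Data.Fin.Base using (Fin)
  open import Data.Fin.Properties using (any?) renaming (_≟_ to _≟ᶠ_)
  open import Data.Fin.Subset using (Subset; _∈_; ∣_∣)
  open import Data.Fin.Subset.Properties using (_∈?_; ∣p∣≤n)
  open import Data.Integer.Base using (ℤ; +_; +≤+; +<+; 0ℤ; _*_; _-_; _≤_; _<_)
  open import Data.Integer.Properties using (+-*-semiring; pos-*; module ≤-Reasoning)
  open import Data.Product.Base using (∃; _×_; _,_; proj₁; proj₂)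
  open import Function.Base using (_∘_)
  open import Relation.Nullary using (¬_; Dec; yes; no; contradiction; _×-dec_; ¬?)
  open import Relation.Binary.PropositionalEquality using (_≡_; _≢_; refl; sym; trans; cong; cong₂; subst; subst₂; module ≡-Reasoning)
  open import Algebra.Properties.Semiring.Sum +-*-semiring using (sum-syntax; ∑-comm; sum-cong-≗)
  open FiniteSums
  open IntegerInequalities
  open NumericContradiction
  open SubsetLemmas

  open FiniteField F using (Carrier; _≈_; _≉_; _≟_; 0#; 1#; enum; enum-inj; enum-surj; size; zeroˡ)
    renaming (_+_ to _+ᶠ_; _*_ to _*ᶠ_; sym to ≈-sym; trans to ≈-trans; *-congʳ to *ᶠ-congʳ)
  open FieldLemmas F
  open Incidences F

  𝟙A 𝟙B : Fin q → ℤ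
  𝟙A i = 𝟙 (i ∈? A)
  𝟙B j = 𝟙 (j ∈? B)

  a b z : ℤ
  a = ∑[ i < q ] 𝟙A i
  b = ∑[ j < q ] 𝟙B j
  z = 𝟙A zeroIndex

  _∈A²? : ∀ u → Dec (proj₁ u ∈ A × proj₂ u ∈ A)
  (i , i′) ∈A²? = i ∈? A ×-dec i′ ∈? A

  _∈B²? : ∀ v → Dec (proj₁ v ∈ B × proj₂ v ∈ B)
  (j , j′) ∈B²? = j ∈? B ×-dec j′ ∈? B

  W U : Point → ℤ
  W u = 𝟙 (u ∈A²? ×-dec ¬? (origin ≟² u))
  U v = 𝟙 (v ∈B²?)

  ∑W : ∑² W ≡ a * a - z * z
  ∑W = begin
    ∑² W                                        ≡⟨ ∑²-cong (λ u → 𝟙-×-¬ (u ∈A²?) (origin ≟² u)) ⟩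
    ∑² (λ u → 𝟙 (u ∈A²?) - 𝟙 (origin ≟² u) * 𝟙 (u ∈A²?)) ≡⟨ ∑²[f-g]≡∑²f-∑²g (λ u → 𝟙 (u ∈A²?)) (λ u → 𝟙 (origin ≟² u) * 𝟙 (u ∈A²?)) ⟩
    ∑² (λ u → 𝟙 (u ∈A²?)) - ∑² (λ u → 𝟙 (origin ≟² u) * 𝟙 (u ∈A²?)) ≡⟨ cong₂ _-_ square (∑²-delta origin (λ u → 𝟙 (u ∈A²?))) ⟩
    a * a - 𝟙 (origin ∈A²?)                   ≡⟨ cong (_-_ (a * a)) (𝟙-× (zeroIndex ∈? A) (zeroIndex ∈? A)) ⟩
    a * a - z * z                               ∎
    where
    open ≡-Reasoning
    square : ∑² (λ u → 𝟙 (u ∈A²?)) ≡ a * a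
    square = trans (∑²-cong λ (i , i′) → 𝟙-× (i ∈? A) (i′ ∈? A)) (sym (∑-*-∑ 𝟙A 𝟙A))

  ∑U : ∑² U ≡ b * b
  ∑U = trans (∑²-cong λ (j , j′) → 𝟙-× (j ∈? B) (j′ ∈? B)) (sym (∑-*-∑ 𝟙B 𝟙B))

  W-origin : W origin ≡ 0ℤ
  W-origin = 𝟙-no (origin ∈A²? ×-dec ¬? (origin ≟² origin)) λ (_ , origin≢origin) → origin≢origin refl

  module AtLevel (c : Carrier) (c≉0 : c ≉ 0#) (2c≉0 : (1# +ᶠ 1#) *ᶠ c ≉ 0#) where
    open Moments 2c≉0 W

    TrivialSolutionsOnly : Set
    TrivialSolutionsOnly = ∀ i i′ j j′ → i ∈ A → i′ ∈ A → j ∈ B → j′ ∈ B →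
      enum i *ᶠ enum j +ᶠ enum i′ *ᶠ enum j′ ≈ (1# +ᶠ 1#) *ᶠ c → enum i *ᶠ enum j ≈ c

    Represents : Fin q × Fin q → Set
    Represents (i , j) = (i ∈ A × j ∈ B) × enum i *ᶠ enum j ≈ c

    represents? : ∀ w → Dec (Represents w)
    represents? (i , j) = (i ∈? A ×-dec j ∈? B) ×-dec ((enum i *ᶠ enum j) ≟ c)

    representations : ℤ
    representations = ∑² (λ w → 𝟙 (represents? w))

    represents⇒≉0 : ∀ {i j} → Represents (i , j) → enum i ≉ 0# × enum j ≉ 0#
    represents⇒≉0 (_ , eᵢeⱼ≈c) = x*y≉0⇒x≉0 eᵢeⱼ≉0 , x*y≉0⇒y≉0 eᵢeⱼ≉0
      where eᵢeⱼ≉0 = λ eᵢeⱼ≈0 → c≉0 (≈-trans (≈-sym eᵢeⱼ≈c) eᵢeⱼ≈0)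

    representations≤a-z : representations ≤ a - z
    representations≤a-z = begin
      ∑[ i < q ] ∑[ j < q ] 𝟙 (represents? (i , j))          ≤⟨ ∑-mono row-bound ⟩
      ∑[ i < q ] 𝟙 (i ∈? A ×-dec ¬? (zeroIndex ≟ᶠ i))       ≡⟨ sum-cong-≗ (λ i → 𝟙-×-¬ (i ∈? A) (zeroIndex ≟ᶠ i)) ⟩
      ∑[ i < q ] (𝟙A i - 𝟙 (zeroIndex ≟ᶠ i) * 𝟙A i)         ≡⟨ ∑[f-g]≡∑f-∑g 𝟙A (λ i → 𝟙 (zeroIndex ≟ᶠ i) * 𝟙A i) ⟩
      a - ∑[ i < q ] (𝟙 (zeroIndex ≟ᶠ i) * 𝟙A i)            ≡⟨ cong (_-_ a) (∑-delta zeroIndex 𝟙A) ⟩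
      a - z                                                 ∎
      where
      open ≤-Reasoning
      row-bound : ∀ i → ∑[ j < q ] 𝟙 (represents? (i , j)) ≤ 𝟙 (i ∈? A ×-dec ¬? (zeroIndex ≟ᶠ i))
      row-bound i = ∑-𝟙-atMostOne (λ j → represents? (i , j)) (i ∈? A ×-dec ¬? (zeroIndex ≟ᶠ i))
        (λ j rep@((i∈A , _) , _) → i∈A , λ { refl → proj₁ (represents⇒≉0 rep) enum-zeroIndex })
        (λ j j′ rep@(_ , eᵢeⱼ≈c) (_ , eᵢeⱼ′≈c) → enum-inj j j′ (*-cancelˡ-≉0 (proj₁ (represents⇒≉0 rep)) (≈-trans eᵢeⱼ≈c (≈-sym eᵢeⱼ′≈c))))

    representations≤b : representations ≤ b
    representations≤b = begin
      ∑[ i < q ] ∑[ j < q ] 𝟙 (represents? (i , j))          ≡⟨ ∑-comm (λ i j → 𝟙 (represents? (i , j))) ⟩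
      ∑[ j < q ] ∑[ i < q ] 𝟙 (represents? (i , j))          ≤⟨ ∑-mono column-bound ⟩
      b                                                     ∎
      where
      open ≤-Reasoning
      column-bound : ∀ j → ∑[ i < q ] 𝟙 (represents? (i , j)) ≤ 𝟙B j
      column-bound j = ∑-𝟙-atMostOne (λ i → represents? (i , j)) (j ∈? B)
        (λ i ((_ , j∈B) , _) → j∈B)
        (λ i i′ rep@(_ , eᵢeⱼ≈c) (_ , eᵢ′eⱼ≈c) → enum-inj i i′ (*-cancelʳ-≉0 (proj₂ (represents⇒≉0 rep)) (≈-trans eᵢeⱼ≈c (≈-sym eᵢ′eⱼ≈c))))

    solutions≤representations² : TrivialSolutionsOnly →
      ∑² (λ v → U v * degree v) ≤ representations * representations
    solutions≤representations² trivial = begin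
      ∑² (λ v → U v * degree v)
        ≡⟨ ∑²-cong (λ v → *-distribˡ-∑² (U v) (λ u → W u * incidence t u v)) ⟩
      ∑² (λ v → ∑² λ u → U v * (W u * incidence t u v))
        ≡⟨ ∑²-comm (λ v u → U v * (W u * incidence t u v)) ⟩
      ∑² (λ u → ∑² λ v → U v * (W u * incidence t u v))
        ≤⟨ ∑²-mono (λ u → ∑²-mono λ v → pointwise u v) ⟩
      ∑² (λ (i , i′) → ∑² λ (j , j′) → T (i , j) * T (i′ , j′))
        ≡⟨ ∑²-transpose (λ i i′ j j′ → T (i , j) * T (i′ , j′)) ⟩
      ∑² (λ w → ∑² λ w′ → T w * T w′)
        ≡⟨ ∑²-*-∑² T T ⟨
      representations * representations ∎
      where
      open ≤-Reasoning
      t = (1# +ᶠ 1#) *ᶠ c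
      T : Fin q × Fin q → ℤ
      T w = 𝟙 (represents? w)
      pointwise : ∀ u v → U v * (W u * incidence t u v) ≤ T (proj₁ u , proj₁ v) * T (proj₂ u , proj₂ v)
      pointwise u@(i , i′) v@(j , j′) = begin
        U v * (W u * incidence t u v)
          ≡⟨ cong (U v *_) (sym (𝟙-× (u ∈A²? ×-dec ¬? (origin ≟² u)) ((vec u · vec v) ≟ t))) ⟩
        U v * 𝟙 ((u ∈A²? ×-dec ¬? (origin ≟² u)) ×-dec ((vec u · vec v) ≟ t))
          ≡⟨ sym (𝟙-× (v ∈B²?) ((u ∈A²? ×-dec ¬? (origin ≟² u)) ×-dec ((vec u · vec v) ≟ t))) ⟩
        𝟙 (v ∈B²? ×-dec ((u ∈A²? ×-dec ¬? (origin ≟² u)) ×-dec ((vec u · vec v) ≟ t)))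
          ≤⟨ 𝟙-mono _ (represents? (i , j) ×-dec represents? (i′ , j′)) both-represent ⟩
        𝟙 (represents? (i , j) ×-dec represents? (i′ , j′))
          ≡⟨ 𝟙-× (represents? (i , j)) (represents? (i′ , j′)) ⟩
        T (i , j) * T (i′ , j′) ∎
        where
        both-represent : _ → Represents (i , j) × Represents (i′ , j′)
        both-represent ((j∈B , j′∈B) , ((i∈A , i′∈A) , _) , on-line) =
          ((i∈A , j∈B) , eᵢeⱼ≈c) , ((i′∈A , j′∈B) , x+y≈2c∧x≈c⇒y≈c on-line eᵢeⱼ≈c)
          where eᵢeⱼ≈c = trivial i i′ j j′ i∈A i′∈A j∈B j′∈B on-line

    ¬trivialSolutionsOnly : + 2 ≤ a → 0ℤ < b → b ≤ + q → + q < a * b →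
      + q * (+ q * + q) < (a * b - + q) * (a * b - + q) → ¬ TrivialSolutionsOnly
    ¬trivialSolutionsOnly 2≤a 0<b b≤q q<ab q³<m² trivial =
      density-contradiction (𝟙-bit (zeroIndex ∈? A)) 2≤a 0<b b≤q q<ab q³<m²
        (∑²-nonneg λ w → 𝟙-nonneg (represents? w)) representations≤a-z representations≤b
        (solutions≤representations² trivial) deviation-bound
      where
      Q = + q
      N = ∑² (λ v → U v * degree v)
      ∑U² : ∑² (λ v → U v * U v) ≡ b * b
      ∑U² = trans (∑²-cong λ v → 𝟙-idem (v ∈B²?)) ∑U
      ∑W² : ∑² (λ u → W u * W u) ≡ a * a - z * z
      ∑W² = trans (∑²-cong λ u → 𝟙-idem (u ∈A²? ×-dec ¬? (origin ≟² u))) ∑W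
      deviation-bound : ((a * a - z * z) * (b * b) - Q * N) * ((a * a - z * z) * (b * b) - Q * N)
                        ≤ (b * b) * (Q * (Q * (Q * (a * a - z * z))))
      deviation-bound = subst₂ _≤_ (cong (λ x → x * x) (cong₂ (λ K β → K * β - Q * N) ∑W ∑U))
                                   (cong₂ (λ β S → β * (Q * (Q * (Q * S)))) ∑U² ∑W²)
        (incidence-bound W-origin (λ u → 𝟙-nonneg (u ∈A²? ×-dec ¬? (origin ≟² u))) U
          (subst (0ℤ <_) (sym ∑U²) (*-pos 0<b 0<b)))

    NontrivialSolution : Set
    NontrivialSolution = ∃ λ i → ∃ λ i′ → ∃ λ j → ∃ λ j′ → ((i ∈ A × i′ ∈ A) × (j ∈ B × j′ ∈ B)) ×
      (enum i *ᶠ enum j +ᶠ enum i′ *ᶠ enum j′ ≈ (1# +ᶠ 1#) *ᶠ c) × enum i *ᶠ enum j ≉ c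

    nontrivialSolution? : Dec NontrivialSolution
    nontrivialSolution? = any? λ i → any? λ i′ → any? λ j → any? λ j′ →
      ((i ∈? A ×-dec i′ ∈? A) ×-dec (j ∈? B ×-dec j′ ∈? B)) ×-dec
      ((enum i *ᶠ enum j +ᶠ enum i′ *ᶠ enum j′) ≟ ((1# +ᶠ 1#) *ᶠ c)) ×-dec ¬? ((enum i *ᶠ enum j) ≟ c)

    ¬nontrivial⇒trivial : ¬ NontrivialSolution → TrivialSolutionsOnly
    ¬nontrivial⇒trivial ∄ i i′ j j′ i∈A i′∈A j∈B j′∈B on-line with (enum i *ᶠ enum j) ≟ c
    ... | yes eᵢeⱼ≈c = eᵢeⱼ≈c
    ... | no  eᵢeⱼ≉c = contradiction (i , i′ , j , j′ , ((i∈A , i′∈A) , (j∈B , j′∈B)) , on-line , eᵢeⱼ≉c) ∄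

  ThreeTermProgression : Set
  ThreeTermProgression = ∃ λ i₀ → ∃ λ i₁ → ∃ λ i₂ → ∃ λ j₀ → ∃ λ j₁ → ∃ λ j₂ →
    i₀ ∈ A × i₁ ∈ A × i₂ ∈ A × j₀ ∈ B × j₁ ∈ B × j₂ ∈ B ×
    (enum i₀ *ᶠ enum j₀ +ᶠ enum i₂ *ᶠ enum j₂ ≈ (1# +ᶠ 1#) *ᶠ (enum i₁ *ᶠ enum j₁)) ×
    ¬ (enum i₀ *ᶠ enum j₀ ≈ enum i₁ *ᶠ enum j₁)

  factors-≥2 : QSqrtQPlusOneLt q (∣ A ∣ ℕ.* ∣ B ∣) → 2 ℕ.≤ ∣ A ∣ × 2 ℕ.≤ ∣ B ∣
  factors-≥2 (q<ab , _) = 2≤-factor q<ab (∣p∣≤n B) , 2≤-factor (subst (q ℕ.<_) (ℕ.*-comm ∣ A ∣ ∣ B ∣) q<ab) (∣p∣≤n A)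

  ≢zeroIndex⇒enum≉0 : ∀ {i} → i ≢ zeroIndex → enum i ≉ 0#
  ≢zeroIndex⇒enum≉0 i≢0 = i≢0 ∘ enum≈0⇒≡zeroIndex

  -- In characteristic two, u + u ≈ 0 ≈ 2 w for all u and w, so (u, w, u) is a progression whenever u ≉ w.
  progression-in-characteristic-two : 1# +ᶠ 1# ≈ 0# → QSqrtQPlusOneLt q (∣ A ∣ ℕ.* ∣ B ∣) → ThreeTermProgression
  progression-in-characteristic-two 2≈0 large
    with ∃-∈-≢ (proj₁ (factors-≥2 large)) zeroIndex | ∃-∈-≢ (proj₂ (factors-≥2 large)) zeroIndex
  ... | i , i∈A , _ | j , j∈B , j≢0 with ∃-∈-≢ (proj₁ (factors-≥2 large)) i
  ... | i′ , i′∈A , i′≢i =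
    i′ , i , i′ , j , j , j , i′∈A , i∈A , i′∈A , j∈B , j∈B , j∈B ,
    ≈-trans (≈-sym (double _)) (≈-trans (twice≈0 _) (≈-sym (twice≈0 _))) ,
    i′≢i ∘ enum-inj i′ i ∘ *-cancelʳ-≉0 (≢zeroIndex⇒enum≉0 j≢0)
    where
    twice≈0 : ∀ x → (1# +ᶠ 1#) *ᶠ x ≈ 0#
    twice≈0 x = ≈-trans (*ᶠ-congʳ 2≈0) (zeroˡ x)

  progression-through : ∀ {i₁ j₁} → i₁ ∈ A → j₁ ∈ B → enum i₁ ≉ 0# → enum j₁ ≉ 0# → 1# +ᶠ 1# ≉ 0# →
    QSqrtQPlusOneLt q (∣ A ∣ ℕ.* ∣ B ∣) → ThreeTermProgression
  progression-through {i₁} {j₁} i₁∈A j₁∈B eᵢ₁≉0 eⱼ₁≉0 2≉0 large@(q<ab , q³<m²) = from-search nontrivialSolution?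
    where
    open AtLevel (enum i₁ *ᶠ enum j₁) (x*y≉0 eᵢ₁≉0 eⱼ₁≉0) (x*y≉0 2≉0 (x*y≉0 eᵢ₁≉0 eⱼ₁≉0))
    ab≡ : a * b ≡ + (∣ A ∣ ℕ.* ∣ B ∣)
    ab≡ = trans (cong₂ _*_ (sym (∣p∣≡∑𝟙∈ A)) (sym (∣p∣≡∑𝟙∈ B))) (sym (pos-* ∣ A ∣ ∣ B ∣))
    2≤a = subst (+ 2 ≤_) (∣p∣≡∑𝟙∈ A) (+≤+ (proj₁ (factors-≥2 large)))
    0<b = subst (0ℤ <_) (∣p∣≡∑𝟙∈ B) (+<+ (ℕ.≤-trans (ℕ.s≤s ℕ.z≤n) (proj₂ (factors-≥2 large))))
    b≤q = subst (_≤ + q) (∣p∣≡∑𝟙∈ B) (+≤+ (∣p∣≤n B))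
    q<ab′ = subst (+ q <_) (sym ab≡) (+<+ q<ab)
    q³<m²′ = subst (λ n → + q * (+ q * + q) < (n - + q) * (n - + q)) (sym ab≡) (cube<square-ℤ q<ab q³<m²)
    from-search : Dec NontrivialSolution → ThreeTermProgression
    from-search (yes (i , i′ , j , j′ , ((i∈A , i′∈A) , (j∈B , j′∈B)) , on-line , eᵢeⱼ≉c)) =
      i , i₁ , i′ , j , j₁ , j′ , i∈A , i₁∈A , i′∈A , j∈B , j₁∈B , j′∈B , on-line , eᵢeⱼ≉c
    from-search (no ∄) = contradiction (¬nontrivial⇒trivial ∄) (¬trivialSolutionsOnly 2≤a 0<b b≤q q<ab′ q³<m²′)

  progression-in-odd-characteristic : 1# +ᶠ 1# ≉ 0# → QSqrtQPlusOneLt q (∣ A ∣ ℕ.* ∣ B ∣) → ThreeTermProgression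
  progression-in-odd-characteristic 2≉0 large
    with ∃-∈-≢ (proj₁ (factors-≥2 large)) zeroIndex | ∃-∈-≢ (proj₂ (factors-≥2 large)) zeroIndex
  ... | i₁ , i₁∈A , i₁≢0 | j₁ , j₁∈B , j₁≢0 =
    progression-through i₁∈A j₁∈B (≢zeroIndex⇒enum≉0 i₁≢0) (≢zeroIndex⇒enum≉0 j₁≢0) 2≉0 large

mainTheorem3 : (F : FiniteField) → let open FiniteField F in
    OddPrimePower size →
    (A B : Subset size) →
    QSqrtQPlusOneLt size (∣ A ∣ *ℕ ∣ B ∣) →
    ∃ λ i₀ → ∃ λ i₁ → ∃ λ i₂ → ∃ λ j₀ → ∃ λ j₁ → ∃ λ j₂ →
      i₀ ∈ A × i₁ ∈ A × i₂ ∈ A × j₀ ∈ B × j₁ ∈ B × j₂ ∈ B ×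
      (enum i₀ * enum j₀ + enum i₂ * enum j₂ ≈ (1# + 1#) * (enum i₁ * enum j₁)) ×
      ¬ (enum i₀ * enum j₀ ≈ enum i₁ * enum j₁)
mainTheorem3 F _ A B large with (1# + 1#) ≟ 0#
  where open FiniteField F
... | yes 2≈0 = ProductSets.progression-in-characteristic-two F A B 2≈0 large
... | no  2≉0 = ProductSets.progression-in-odd-characteristic F A B 2≉0 large
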